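{- Let $T=\mathrm{conv}(v_1,v_2,v_3,v_4)$ be a 1-point lattice tetrahedron with interior lattice point $w$. Then the four lattice tetrahedra $T_1=\mathrm{conv}(v_2,v_3,v_4,w)$, $T_2=\mathrm{conv}(v_1,v_3,v_4,w)$, $T_3=\mathrm{conv}(v_1,v_2,v_4,w)$, $T_4=\mathrm{conv}(v_1,v_2,v_3,w)$ are empty (i.e. each is clean and has no interior lattice points).
   Context: A lattice tetrahedron is a non-degenerate tetrahedron with vertices in $\mathbb{Z}^3$; it is clean if the only lattice points on its boundary are its vertices. A clean lattice tetrahedron is empty if it has no interior lattice points, and is a 1-point lattice tetrahedron if it has exactly one interior lattice point. -}

module Defs where

open import Data.Nat using (ℕ; _>_)
import Data.Nat as ℕ
open import Data.Integer using (ℤ; +_; _+_; _-_; _*_)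
open import Data.Fin using (Fin; zero; suc; _≟_)
open import Data.Product using (Σ; ∃; _×_; _,_)
open import Relation.Binary.PropositionalEquality using (_≡_; _≢_)
open import Relation.Nullary using (¬_; yes; no)

Pt : Set
Pt = ℤ × ℤ × ℤ

_⊕_ : Pt → Pt → Pt
(a , b , c) ⊕ (d , e , f) = (a + d , b + e , c + f)

_⊖_ : Pt → Pt → Pt
(a , b , c) ⊖ (d , e , f) = (a - d , b - e , c - f)

_·_ : ℕ → Pt → Pt
n · (a , b , c) = (+ n * a , + n * b , + n * c)

det3 : Pt → Pt → Pt → ℤ
det3 (a₁ , a₂ , a₃) (b₁ , b₂ , b₃) (c₁ , c₂ , c₃) =
  a₁ * (b₂ * c₃ - b₃ * c₂) - a₂ * (b₁ * c₃ - b₃ * c₁) + a₃ * (b₁ * c₂ - b₂ * c₁)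

Tet : Set
Tet = Fin 4 → Pt

NonDegenerate : Tet → Set
NonDegenerate v =
  det3 (v (suc zero) ⊖ v zero) (v (suc (suc zero)) ⊖ v zero) (v (suc (suc (suc zero))) ⊖ v zero) ≢ + 0

lin : (Fin 4 → ℕ) → Tet → Pt
lin c v = (c zero · v zero) ⊕ ((c (suc zero) · v (suc zero)) ⊕
          ((c (suc (suc zero)) · v (suc (suc zero))) ⊕ (c (suc (suc (suc zero))) · v (suc (suc (suc zero))))))

csum : (Fin 4 → ℕ) → ℕ
csum c = c zero ℕ.+ (c (suc zero) ℕ.+ (c (suc (suc zero)) ℕ.+ c (suc (suc (suc zero)))))

-- A lattice point p lies in conv(v): p = Σ λᵢ vᵢ with λᵢ ≥ 0, Σ λᵢ = 1.
-- (Rational λᵢ, denominators cleared: λᵢ = cᵢ / Σ c.)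
InConv : Tet → Pt → Set
InConv v p = Σ (Fin 4 → ℕ) λ c → (csum c > 0) × (csum c · p ≡ lin c v)

InInterior : Tet → Pt → Set
InInterior v p = Σ (Fin 4 → ℕ) λ c → (∀ i → c i > 0) × (csum c · p ≡ lin c v)

OnBoundary : Tet → Pt → Set
OnBoundary v p = InConv v p × ¬ InInterior v p

Clean : Tet → Set
Clean v = ∀ p → OnBoundary v p → ∃ λ i → p ≡ v i

EmptyTet : Tet → Set
EmptyTet v = NonDegenerate v × Clean v × (∀ p → ¬ InInterior v p)

OnePointTetWith : Tet → Pt → Set
OnePointTetWith v w = NonDegenerate v × Clean v × InInterior v w × (∀ p → InInterior v p → p ≡ w)

replace : Tet → Fin 4 → Pt → Tet
replace v i w j with j ≟ i
... | yes _ = w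
... | no _ = v j

{-# OPTIONS --safe #-}
module Submission where

-- Write points in barycentric coordinates with respect to T. By Cramer's rule the i-th coordinate
-- of p is vol (T with vᵢ replaced by p) / vol T; as w is interior, all its coordinates are
-- positive, so every Tᵢ is non-degenerate. Let p be a lattice point of Tᵢ. Substituting the
-- barycentric expression of w, p is a combination of the vertices of T whose weights are all
-- positive if p has positive weight on w; then p is interior to T, so p = w, a vertex of Tᵢ, and
-- vertices are never interior. If instead p has weight 0 on w, it lies on the face of T opposite
-- vᵢ, hence on the boundary of T, so by cleanness of T it is a vertex vⱼ with j ≠ i.

open import Algebra.Bundles using (CommutativeRing)
import Algebra.Construct.DirectProduct as DirectProduct
open import Algebra.Solver.Ring.AlmostCommutativeRing using (fromCommutativeRing)
import Algebra.Solver.Ring.Simple as RingSolver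
open import Data.Empty using (⊥-elim)
open import Data.Fin.Base using (Fin)
open import Data.Fin.Patterns using (0F; 1F; 2F; 3F)
open import Data.Fin.Properties using (_≟_)
open import Data.Integer.Base using (ℤ; +_; _+_; _*_; -_; ≢-nonZero)
import Data.Integer.Properties as ℤₚ
open import Data.Integer.Solver using (module +-*-Solver)
open import Data.Nat.Base as ℕ using (ℕ; zero; suc; _<_; z<s)
import Data.Nat.Properties as ℕₚ
open import Data.Product.Base using (Σ; ∃; _×_; _,_; proj₁; proj₂)
open import Data.Product.Relation.Binary.Pointwise.NonDependent using (×-decidable; ≡×≡⇒≡)
open import Data.Sum.Base using (inj₁; inj₂)
open import Data.Vec.Functional using (updateAt)
import Data.Vec.Functional as Vector
open import Data.Vec.Functional.Properties using (map-updateAt; updateAt-updates)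
open import Function.Base using (const)
open import Level using (0ℓ)
open import Relation.Binary.PropositionalEquality
open import Relation.Nullary using (¬_; yes; no)

open import Algebra.Properties.CommutativeSemigroup ℤₚ.*-commutativeSemigroup using (x∙yz≈y∙xz)

open import Defs

open ≡-Reasoning

infixr 25 _⊛_

_⊛_ : ℤ → Pt → Pt
k ⊛ (x , y , z) = (k * x , k * y , k * z)

-- Points form the ring ℤ³ under componentwise operations, in which a scalar k acts as the
-- diagonal point (k , k , k); identities between points are proved by the ring solver for ℤ³.
ℤ³ : CommutativeRing 0ℓ 0ℓ
ℤ³ = DirectProduct.commutativeRing ℤₚ.+-*-commutativeRing
       (DirectProduct.commutativeRing ℤₚ.+-*-commutativeRing ℤₚ.+-*-commutativeRing)

module ℤ³-Solver =
  RingSolver (fromCommutativeRing ℤ³) (×-decidable ℤₚ._≟_ (×-decidable ℤₚ._≟_ ℤₚ._≟_))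

open CommutativeRing ℤ³ using () renaming (_≈_ to _≈³_; refl to ≈³-refl; 0# to 0³)

diagonal : ℤ → Pt
diagonal k = (k , k , k)

≈³⇒≡ : ∀ {p q} → p ≈³ q → p ≡ q
≈³⇒≡ (x , yz) = ≡×≡⇒≡ (x , ≡×≡⇒≡ yz)

module Symbolic {n : ℕ} where
  open +-*-Solver using (Polynomial; _:+_; _:*_; _:-_)

  infixr 25 _⊛ᴾ_

  Pointᴾ : Set
  Pointᴾ = Polynomial n × Polynomial n × Polynomial n

  _⊛ᴾ_ : Polynomial n → Pointᴾ → Pointᴾ
  k ⊛ᴾ (x , y , z) = (k :* x , k :* y , k :* z)

  _⊕ᴾ_ _⊖ᴾ_ : Pointᴾ → Pointᴾ → Pointᴾ
  (a , b , c) ⊕ᴾ (d , e , f) = (a :+ d , b :+ e , c :+ f)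
  (a , b , c) ⊖ᴾ (d , e , f) = (a :- d , b :- e , c :- f)

  det3ᴾ : Pointᴾ → Pointᴾ → Pointᴾ → Polynomial n
  det3ᴾ (a₁ , a₂ , a₃) (b₁ , b₂ , b₃) (c₁ , c₂ , c₃) =
    a₁ :* (b₂ :* c₃ :- b₃ :* c₂) :- a₂ :* (b₁ :* c₃ :- b₃ :* c₁)
      :+ a₃ :* (b₁ :* c₂ :- b₂ :* c₁)

module _ where
  open +-*-Solver using (solve; _:=_; _:*_; :-_)
  open Symbolic

  det3-scale₁ : ∀ S x q r → S * det3 x q r ≡ det3 (S ⊛ x) q r
  det3-scale₁ S (x₁ , x₂ , x₃) (q₁ , q₂ , q₃) (r₁ , r₂ , r₃) =
    solve 10 (λ S x₁ x₂ x₃ q₁ q₂ q₃ r₁ r₂ r₃ →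
      let x = (x₁ , x₂ , x₃) ; q = (q₁ , q₂ , q₃) ; r = (r₁ , r₂ , r₃) in
      S :* det3ᴾ x q r := det3ᴾ (S ⊛ᴾ x) q r)
      refl S x₁ x₂ x₃ q₁ q₂ q₃ r₁ r₂ r₃

  det3-scale₂ : ∀ S p x r → S * det3 p x r ≡ det3 p (S ⊛ x) r
  det3-scale₂ S (p₁ , p₂ , p₃) (x₁ , x₂ , x₃) (r₁ , r₂ , r₃) =
    solve 10 (λ S p₁ p₂ p₃ x₁ x₂ x₃ r₁ r₂ r₃ →
      let p = (p₁ , p₂ , p₃) ; x = (x₁ , x₂ , x₃) ; r = (r₁ , r₂ , r₃) in
      S :* det3ᴾ p x r := det3ᴾ p (S ⊛ᴾ x) r)
      refl S p₁ p₂ p₃ x₁ x₂ x₃ r₁ r₂ r₃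

  det3-scale₃ : ∀ S p q x → S * det3 p q x ≡ det3 p q (S ⊛ x)
  det3-scale₃ S (p₁ , p₂ , p₃) (q₁ , q₂ , q₃) (x₁ , x₂ , x₃) =
    solve 10 (λ S p₁ p₂ p₃ q₁ q₂ q₃ x₁ x₂ x₃ →
      let p = (p₁ , p₂ , p₃) ; q = (q₁ , q₂ , q₃) ; x = (x₁ , x₂ , x₃) in
      S :* det3ᴾ p q x := det3ᴾ p q (S ⊛ᴾ x))
      refl S p₁ p₂ p₃ q₁ q₂ q₃ x₁ x₂ x₃

  det3-combination₁ : ∀ a b c p q r → det3 (a ⊛ p ⊕ (b ⊛ q ⊕ c ⊛ r)) q r ≡ a * det3 p q r
  det3-combination₁ a b c (p₁ , p₂ , p₃) (q₁ , q₂ , q₃) (r₁ , r₂ , r₃) =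
    solve 12 (λ a b c p₁ p₂ p₃ q₁ q₂ q₃ r₁ r₂ r₃ →
      let p = (p₁ , p₂ , p₃) ; q = (q₁ , q₂ , q₃) ; r = (r₁ , r₂ , r₃) in
      det3ᴾ (a ⊛ᴾ p ⊕ᴾ (b ⊛ᴾ q ⊕ᴾ c ⊛ᴾ r)) q r := a :* det3ᴾ p q r)
      refl a b c p₁ p₂ p₃ q₁ q₂ q₃ r₁ r₂ r₃

  det3-combination₂ : ∀ a b c p q r → det3 p (a ⊛ p ⊕ (b ⊛ q ⊕ c ⊛ r)) r ≡ b * det3 p q r
  det3-combination₂ a b c (p₁ , p₂ , p₃) (q₁ , q₂ , q₃) (r₁ , r₂ , r₃) =
    solve 12 (λ a b c p₁ p₂ p₃ q₁ q₂ q₃ r₁ r₂ r₃ →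
      let p = (p₁ , p₂ , p₃) ; q = (q₁ , q₂ , q₃) ; r = (r₁ , r₂ , r₃) in
      det3ᴾ p (a ⊛ᴾ p ⊕ᴾ (b ⊛ᴾ q ⊕ᴾ c ⊛ᴾ r)) r := b :* det3ᴾ p q r)
      refl a b c p₁ p₂ p₃ q₁ q₂ q₃ r₁ r₂ r₃

  det3-combination₃ : ∀ a b c p q r → det3 p q (a ⊛ p ⊕ (b ⊛ q ⊕ c ⊛ r)) ≡ c * det3 p q r
  det3-combination₃ a b c (p₁ , p₂ , p₃) (q₁ , q₂ , q₃) (r₁ , r₂ , r₃) =
    solve 12 (λ a b c p₁ p₂ p₃ q₁ q₂ q₃ r₁ r₂ r₃ →
      let p = (p₁ , p₂ , p₃) ; q = (q₁ , q₂ , q₃) ; r = (r₁ , r₂ , r₃) in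
      det3ᴾ p q (a ⊛ᴾ p ⊕ᴾ (b ⊛ᴾ q ⊕ᴾ c ⊛ᴾ r)) := c :* det3ᴾ p q r)
      refl a b c p₁ p₂ p₃ q₁ q₂ q₃ r₁ r₂ r₃

  det3-⊖-swap : ∀ p q r s → det3 (q ⊖ p) (r ⊖ p) (s ⊖ p) ≡ - det3 (p ⊖ q) (r ⊖ q) (s ⊖ q)
  det3-⊖-swap (p₁ , p₂ , p₃) (q₁ , q₂ , q₃) (r₁ , r₂ , r₃) (s₁ , s₂ , s₃) =
    solve 12 (λ p₁ p₂ p₃ q₁ q₂ q₃ r₁ r₂ r₃ s₁ s₂ s₃ →
      let p = (p₁ , p₂ , p₃) ; q = (q₁ , q₂ , q₃) ; r = (r₁ , r₂ , r₃) ; s = (s₁ , s₂ , s₃) in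
      det3ᴾ (q ⊖ᴾ p) (r ⊖ᴾ p) (s ⊖ᴾ p) := :- det3ᴾ (p ⊖ᴾ q) (r ⊖ᴾ q) (s ⊖ᴾ q))
      refl p₁ p₂ p₃ q₁ q₂ q₃ r₁ r₂ r₃ s₁ s₂ s₃

det3-cramer : ∀ S a b c x p q r → S ⊛ x ≡ a ⊛ p ⊕ (b ⊛ q ⊕ c ⊛ r) →
  (S * det3 x q r ≡ a * det3 p q r) × (S * det3 p x r ≡ b * det3 p q r) ×
  (S * det3 p q x ≡ c * det3 p q r)
det3-cramer S a b c x p q r h =
  trans (det3-scale₁ S x q r) (trans (cong (λ y → det3 y q r) h) (det3-combination₁ a b c p q r)) ,
  trans (det3-scale₂ S p x r) (trans (cong (λ y → det3 p y r) h) (det3-combination₂ a b c p q r)) ,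
  trans (det3-scale₃ S p q x) (trans (cong (det3 p q) h) (det3-combination₃ a b c p q r))

total : (Fin 4 → ℤ) → ℤ
total a = a 0F + (a 1F + (a 2F + a 3F))

combination : (Fin 4 → ℤ) → Tet → Pt
combination a v = a 0F ⊛ v 0F ⊕ (a 1F ⊛ v 1F ⊕ (a 2F ⊛ v 2F ⊕ a 3F ⊛ v 3F))

record Barycentric (a : Fin 4 → ℤ) (v : Tet) (p : Pt) : Set where
  constructor barycentric
  field equation : total a ⊛ p ≡ combination a v

open Barycentric

total-cong : ∀ {a b} → (∀ j → a j ≡ b j) → total a ≡ total b
total-cong e = cong₂ _+_ (e 0F) (cong₂ _+_ (e 1F) (cong₂ _+_ (e 2F) (e 3F)))

combination-cong : ∀ {a b} v → (∀ j → a j ≡ b j) → combination a v ≡ combination b v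
combination-cong v e = cong₂ _⊕_ (cong (_⊛ v 0F) (e 0F)) (cong₂ _⊕_ (cong (_⊛ v 1F) (e 1F))
  (cong₂ _⊕_ (cong (_⊛ v 2F) (e 2F)) (cong (_⊛ v 3F) (e 3F))))

Barycentric-cong : ∀ {a b v p} → (∀ j → a j ≡ b j) → Barycentric a v p → Barycentric b v p
Barycentric-cong {a} {b} {v} {p} e h = barycentric (begin
  total b ⊛ p      ≡⟨ cong (_⊛ p) (total-cong e) ⟨
  total a ⊛ p      ≡⟨ equation h ⟩
  combination a v  ≡⟨ combination-cong v e ⟩
  combination b v  ∎)

⊛-⊖-distrib : ∀ k p q → k ⊛ (p ⊖ q) ≡ k ⊛ p ⊖ k ⊛ q
⊛-⊖-distrib k p q =
  ≈³⇒≡ (solve 3 (λ k p q → k :* (p :- q) := k :* p :- k :* q) ≈³-refl (diagonal k) p q)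
  where open ℤ³-Solver using (solve; _:=_; _:*_; _:-_)

relative-to-v₀ : ∀ {a v p} → Barycentric a v p →
  total a ⊛ (p ⊖ v 0F) ≡ a 1F ⊛ (v 1F ⊖ v 0F) ⊕ (a 2F ⊛ (v 2F ⊖ v 0F) ⊕ a 3F ⊛ (v 3F ⊖ v 0F))
relative-to-v₀ {a} {v} {p} h = begin
  total a ⊛ (p ⊖ v 0F)              ≡⟨ ⊛-⊖-distrib (total a) p (v 0F) ⟩
  total a ⊛ p ⊖ total a ⊛ v 0F      ≡⟨ cong (_⊖ total a ⊛ v 0F) (equation h) ⟩
  combination a v ⊖ total a ⊛ v 0F  ≡⟨ ≈³⇒≡ (solve 8 (λ a₀ a₁ a₂ a₃ v₀ v₁ v₂ v₃ →
      a₀ :* v₀ :+ (a₁ :* v₁ :+ (a₂ :* v₂ :+ a₃ :* v₃)) :- (a₀ :+ (a₁ :+ (a₂ :+ a₃))) :* v₀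
        := a₁ :* (v₁ :- v₀) :+ (a₂ :* (v₂ :- v₀) :+ a₃ :* (v₃ :- v₀)))
      ≈³-refl (diagonal (a 0F)) (diagonal (a 1F)) (diagonal (a 2F)) (diagonal (a 3F))
      (v 0F) (v 1F) (v 2F) (v 3F)) ⟩
  a 1F ⊛ (v 1F ⊖ v 0F) ⊕ (a 2F ⊛ (v 2F ⊖ v 0F) ⊕ a 3F ⊛ (v 3F ⊖ v 0F)) ∎
  where open ℤ³-Solver using (solve; _:=_; _:+_; _:*_; _:-_)

relative-to-v₁ : ∀ {a v p} → Barycentric a v p →
  total a ⊛ (p ⊖ v 1F) ≡ a 0F ⊛ (v 0F ⊖ v 1F) ⊕ (a 2F ⊛ (v 2F ⊖ v 1F) ⊕ a 3F ⊛ (v 3F ⊖ v 1F))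
relative-to-v₁ {a} {v} {p} h = begin
  total a ⊛ (p ⊖ v 1F)              ≡⟨ ⊛-⊖-distrib (total a) p (v 1F) ⟩
  total a ⊛ p ⊖ total a ⊛ v 1F      ≡⟨ cong (_⊖ total a ⊛ v 1F) (equation h) ⟩
  combination a v ⊖ total a ⊛ v 1F  ≡⟨ ≈³⇒≡ (solve 8 (λ a₀ a₁ a₂ a₃ v₀ v₁ v₂ v₃ →
      a₀ :* v₀ :+ (a₁ :* v₁ :+ (a₂ :* v₂ :+ a₃ :* v₃)) :- (a₀ :+ (a₁ :+ (a₂ :+ a₃))) :* v₁
        := a₀ :* (v₀ :- v₁) :+ (a₂ :* (v₂ :- v₁) :+ a₃ :* (v₃ :- v₁)))
      ≈³-refl (diagonal (a 0F)) (diagonal (a 1F)) (diagonal (a 2F)) (diagonal (a 3F))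
      (v 0F) (v 1F) (v 2F) (v 3F)) ⟩
  a 0F ⊛ (v 0F ⊖ v 1F) ⊕ (a 2F ⊛ (v 2F ⊖ v 1F) ⊕ a 3F ⊛ (v 3F ⊖ v 1F)) ∎
  where open ℤ³-Solver using (solve; _:=_; _:+_; _:*_; _:-_)

vol : Tet → ℤ
vol v = det3 (v 1F ⊖ v 0F) (v 2F ⊖ v 0F) (v 3F ⊖ v 0F)

cramer : ∀ {a v p} → Barycentric a v p → ∀ i → total a * vol (replace v i p) ≡ a i * vol v
cramer {a} {v} {p} h = λ where
    0F → begin
      total a * vol (replace v 0F p)        ≡⟨ cong (total a *_) (det3-⊖-swap p (v 1F) (v 2F) (v 3F)) ⟩
      total a * - det3 (p ⊖ v 1F) w₂ w₃     ≡⟨ ℤₚ.neg-distribʳ-* (total a) _ ⟨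
      - (total a * det3 (p ⊖ v 1F) w₂ w₃)   ≡⟨ cong -_ (proj₁ rows-at-v₁) ⟩
      - (a 0F * det3 w₀ w₂ w₃)              ≡⟨ ℤₚ.neg-distribʳ-* (a 0F) _ ⟩
      a 0F * - det3 w₀ w₂ w₃                ≡⟨ cong (a 0F *_) (det3-⊖-swap (v 0F) (v 1F) (v 2F) (v 3F)) ⟨
      a 0F * vol v                          ∎
    1F → proj₁ rows-at-v₀
    2F → proj₁ (proj₂ rows-at-v₀)
    3F → proj₂ (proj₂ rows-at-v₀)
  where
  rows-at-v₀ = det3-cramer (total a) (a 1F) (a 2F) (a 3F)
    (p ⊖ v 0F) (v 1F ⊖ v 0F) (v 2F ⊖ v 0F) (v 3F ⊖ v 0F) (relative-to-v₀ h)
  -- vol is measured from v 0, the vertex replaced when i = 0; measure from v 1 instead.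
  w₀ = v 0F ⊖ v 1F
  w₂ = v 2F ⊖ v 1F
  w₃ = v 3F ⊖ v 1F
  rows-at-v₁ = det3-cramer (total a) (a 0F) (a 2F) (a 3F) (p ⊖ v 1F) w₀ w₂ w₃ (relative-to-v₁ h)

module _ where
  open ℤ³-Solver using (solve; _:=_; _:+_; _:*_; con)

  combination-replace : ∀ a v w i →
    combination a (replace v i w) ≡ combination (updateAt a i (const (+ 0))) v ⊕ a i ⊛ w
  combination-replace a v w 0F = ≈³⇒≡ (solve 9 (λ a₀ a₁ a₂ a₃ v₀ v₁ v₂ v₃ w →
      a₀ :* w :+ (a₁ :* v₁ :+ (a₂ :* v₂ :+ a₃ :* v₃))
        := con 0³ :+ (a₁ :* v₁ :+ (a₂ :* v₂ :+ a₃ :* v₃)) :+ a₀ :* w)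
    ≈³-refl (diagonal (a 0F)) (diagonal (a 1F)) (diagonal (a 2F)) (diagonal (a 3F)) (v 0F) (v 1F) (v 2F) (v 3F) w)
  combination-replace a v w 1F = ≈³⇒≡ (solve 9 (λ a₀ a₁ a₂ a₃ v₀ v₁ v₂ v₃ w →
      a₀ :* v₀ :+ (a₁ :* w :+ (a₂ :* v₂ :+ a₃ :* v₃))
        := a₀ :* v₀ :+ (con 0³ :+ (a₂ :* v₂ :+ a₃ :* v₃)) :+ a₁ :* w)
    ≈³-refl (diagonal (a 0F)) (diagonal (a 1F)) (diagonal (a 2F)) (diagonal (a 3F)) (v 0F) (v 1F) (v 2F) (v 3F) w)
  combination-replace a v w 2F = ≈³⇒≡ (solve 9 (λ a₀ a₁ a₂ a₃ v₀ v₁ v₂ v₃ w →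
      a₀ :* v₀ :+ (a₁ :* v₁ :+ (a₂ :* w :+ a₃ :* v₃))
        := a₀ :* v₀ :+ (a₁ :* v₁ :+ (con 0³ :+ a₃ :* v₃)) :+ a₂ :* w)
    ≈³-refl (diagonal (a 0F)) (diagonal (a 1F)) (diagonal (a 2F)) (diagonal (a 3F)) (v 0F) (v 1F) (v 2F) (v 3F) w)
  combination-replace a v w 3F = ≈³⇒≡ (solve 9 (λ a₀ a₁ a₂ a₃ v₀ v₁ v₂ v₃ w →
      a₀ :* v₀ :+ (a₁ :* v₁ :+ (a₂ :* v₂ :+ a₃ :* w))
        := a₀ :* v₀ :+ (a₁ :* v₁ :+ (a₂ :* v₂ :+ con 0³)) :+ a₃ :* w)
    ≈³-refl (diagonal (a 0F)) (diagonal (a 1F)) (diagonal (a 2F)) (diagonal (a 3F)) (v 0F) (v 1F) (v 2F) (v 3F) w)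

  ⊛-assoc : ∀ k l p → (k * l) ⊛ p ≡ k ⊛ (l ⊛ p)
  ⊛-assoc k l p =
    ≈³⇒≡ (solve 3 (λ k l p → (k :* l) :* p := k :* (l :* p)) ≈³-refl (diagonal k) (diagonal l) p)

  combination-linear : ∀ k l a b v →
    k ⊛ combination a v ⊕ l ⊛ combination b v ≡ combination (λ j → k * a j + l * b j) v
  combination-linear k l a b v = ≈³⇒≡ (solve 14 (λ k l a₀ a₁ a₂ a₃ b₀ b₁ b₂ b₃ v₀ v₁ v₂ v₃ →
      k :* (a₀ :* v₀ :+ (a₁ :* v₁ :+ (a₂ :* v₂ :+ a₃ :* v₃)))
        :+ l :* (b₀ :* v₀ :+ (b₁ :* v₁ :+ (b₂ :* v₂ :+ b₃ :* v₃)))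
      := (k :* a₀ :+ l :* b₀) :* v₀ :+ ((k :* a₁ :+ l :* b₁) :* v₁
           :+ ((k :* a₂ :+ l :* b₂) :* v₂ :+ (k :* a₃ :+ l :* b₃) :* v₃)))
    ≈³-refl (diagonal k) (diagonal l)
    (diagonal (a 0F)) (diagonal (a 1F)) (diagonal (a 2F)) (diagonal (a 3F))
    (diagonal (b 0F)) (diagonal (b 1F)) (diagonal (b 2F)) (diagonal (b 3F)) (v 0F) (v 1F) (v 2F) (v 3F))

module _ where
  open +-*-Solver using (solve; _:=_; _:+_; con)

  total-updateAt : ∀ a i → total (updateAt a i (const (+ 0))) + a i ≡ total a
  total-updateAt a 0F = solve 4 (λ a₀ a₁ a₂ a₃ →
    con (+ 0) :+ (a₁ :+ (a₂ :+ a₃)) :+ a₀ := a₀ :+ (a₁ :+ (a₂ :+ a₃))) refl (a 0F) (a 1F) (a 2F) (a 3F)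
  total-updateAt a 1F = solve 4 (λ a₀ a₁ a₂ a₃ →
    a₀ :+ (con (+ 0) :+ (a₂ :+ a₃)) :+ a₁ := a₀ :+ (a₁ :+ (a₂ :+ a₃))) refl (a 0F) (a 1F) (a 2F) (a 3F)
  total-updateAt a 2F = solve 4 (λ a₀ a₁ a₂ a₃ →
    a₀ :+ (a₁ :+ (con (+ 0) :+ a₃)) :+ a₂ := a₀ :+ (a₁ :+ (a₂ :+ a₃))) refl (a 0F) (a 1F) (a 2F) (a 3F)
  total-updateAt a 3F = solve 4 (λ a₀ a₁ a₂ a₃ →
    a₀ :+ (a₁ :+ (a₂ :+ con (+ 0))) :+ a₃ := a₀ :+ (a₁ :+ (a₂ :+ a₃))) refl (a 0F) (a 1F) (a 2F) (a 3F)

-- The weights of p with respect to v obtained by substituting w = Σ bⱼ vⱼ / Σ b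
-- into p = Σ aⱼ uⱼ / Σ a, where u = replace v i w.
substitute : Fin 4 → (Fin 4 → ℤ) → (Fin 4 → ℤ) → Fin 4 → ℤ
substitute i a b j = total b * updateAt a i (const (+ 0)) j + a i * b j

total-substitute : ∀ i a b → total (substitute i a b) ≡ total b * total a
total-substitute i a b = begin
  total (substitute i a b)    ≡⟨ factor (a i) (a′ 0F) (a′ 1F) (a′ 2F) (a′ 3F) (b 0F) (b 1F) (b 2F) (b 3F) ⟩
  total b * (total a′ + a i)  ≡⟨ cong (total b *_) (total-updateAt a i) ⟩
  total b * total a           ∎
  where
  open +-*-Solver using (solve; _:=_; _:+_; _:*_)
  a′ = updateAt a i (const (+ 0))
  factor = solve 9 (λ l a₀ a₁ a₂ a₃ b₀ b₁ b₂ b₃ → let k = b₀ :+ (b₁ :+ (b₂ :+ b₃)) in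
    k :* a₀ :+ l :* b₀ :+ (k :* a₁ :+ l :* b₁ :+ (k :* a₂ :+ l :* b₂ :+ (k :* a₃ :+ l :* b₃)))
      := k :* (a₀ :+ (a₁ :+ (a₂ :+ a₃)) :+ l)) refl

Barycentric-substitute : ∀ {a b v w p} i → Barycentric b v w → Barycentric a (replace v i w) p →
  Barycentric (substitute i a b) v p
Barycentric-substitute {a} {b} {v} {w} {p} i hw hp = barycentric (begin
  total (substitute i a b) ⊛ p                        ≡⟨ cong (_⊛ p) (total-substitute i a b) ⟩
  (total b * total a) ⊛ p                             ≡⟨ ⊛-assoc (total b) (total a) p ⟩
  total b ⊛ (total a ⊛ p)                             ≡⟨ cong (total b ⊛_) (equation hp) ⟩
  total b ⊛ combination a (replace v i w)             ≡⟨ cong (total b ⊛_) (combination-replace a v w i) ⟩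
  total b ⊛ (combination a′ v ⊕ a i ⊛ w)              ≡⟨ regroup ⟩
  total b ⊛ combination a′ v ⊕ a i ⊛ (total b ⊛ w)    ≡⟨ cong (λ q → total b ⊛ combination a′ v ⊕ a i ⊛ q)
                                                            (equation hw) ⟩
  total b ⊛ combination a′ v ⊕ a i ⊛ combination b v  ≡⟨ combination-linear (total b) (a i) a′ b v ⟩
  combination (substitute i a b) v                    ∎)
  where
  open ℤ³-Solver using (solve; _:=_; _:+_; _:*_)
  a′ = updateAt a i (const (+ 0))
  regroup = ≈³⇒≡ (solve 4 (λ k l q w → k :* (q :+ l :* w) := k :* q :+ l :* (k :* w)) ≈³-refl
    (diagonal (total b)) (diagonal (a i)) (combination a′ v) w)

total-+ : ∀ c → + csum c ≡ total (Vector.map +_ c)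
total-+ c = trans (ℤₚ.pos-+ (c 0F) _) (cong (λ x → + c 0F + x)
  (trans (ℤₚ.pos-+ (c 1F) _) (cong (λ x → + c 1F + x) (ℤₚ.pos-+ (c 2F) (c 3F)))))

Barycentric-fromℕ : ∀ c {v p} → csum c · p ≡ lin c v → Barycentric (Vector.map +_ c) v p
Barycentric-fromℕ c {v} {p} h = barycentric (subst (λ s → s ⊛ p ≡ lin c v) (total-+ c) h)

Barycentric-toℕ : ∀ c {v p} → Barycentric (Vector.map +_ c) v p → csum c · p ≡ lin c v
Barycentric-toℕ c {v} {p} h = subst (λ s → s ⊛ p ≡ lin c v) (sym (total-+ c)) (equation h)

cramerℕ : ∀ c {v p} → csum c · p ≡ lin c v → ∀ i → + csum c * vol (replace v i p) ≡ + c i * vol v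
cramerℕ c {v} {p} h i = subst (λ s → s * vol (replace v i p) ≡ + c i * vol v) (sym (total-+ c))
  (cramer (Barycentric-fromℕ c h) i)

substituteℕ : Fin 4 → (Fin 4 → ℕ) → (Fin 4 → ℕ) → Fin 4 → ℕ
substituteℕ i c d j = csum d ℕ.* updateAt c i (const 0) j ℕ.+ c i ℕ.* d j

substituteℕ-+ : ∀ i c d j → substitute i (Vector.map +_ c) (Vector.map +_ d) j ≡ + substituteℕ i c d j
substituteℕ-+ i c d j = sym (begin
  + (csum d ℕ.* u j ℕ.+ c i ℕ.* d j)     ≡⟨ ℤₚ.pos-+ (csum d ℕ.* u j) _ ⟩
  + (csum d ℕ.* u j) + + (c i ℕ.* d j)   ≡⟨ cong₂ _+_ (ℤₚ.pos-* (csum d) (u j)) (ℤₚ.pos-* (c i) (d j)) ⟩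
  + csum d * + u j + + c i * + d j       ≡⟨ cong₂ (λ s t → s * t + + c i * + d j) (total-+ d)
                                              (map-updateAt {f = +_} (λ _ → refl) c i j) ⟩
  substitute i (Vector.map +_ c) (Vector.map +_ d) j ∎)
  where
  u = updateAt c i (const 0)

substituteℕ-barycentric : ∀ i c d {v w p} → csum d · w ≡ lin d v → csum c · p ≡ lin c (replace v i w) →
  csum (substituteℕ i c d) · p ≡ lin (substituteℕ i c d) v
substituteℕ-barycentric i c d hw hp =
  Barycentric-toℕ (substituteℕ i c d) (Barycentric-cong (substituteℕ-+ i c d)
    (Barycentric-substitute i (Barycentric-fromℕ d hw) (Barycentric-fromℕ c hp)))

csum-substituteℕ : ∀ i c d → csum (substituteℕ i c d) ≡ csum d ℕ.* csum c
csum-substituteℕ i c d = ℤₚ.+-injective (begin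
  + csum (substituteℕ i c d)                 ≡⟨ total-+ (substituteℕ i c d) ⟩
  total (Vector.map +_ (substituteℕ i c d))  ≡⟨ total-cong (substituteℕ-+ i c d) ⟨
  total (substitute i c′ d′)                 ≡⟨ total-substitute i c′ d′ ⟩
  total d′ * total c′                        ≡⟨ cong₂ _*_ (total-+ d) (total-+ c) ⟨
  + csum d * + csum c                        ≡⟨ ℤₚ.pos-* (csum d) (csum c) ⟨
  + (csum d ℕ.* csum c)                      ∎)
  where
  c′ = Vector.map +_ c
  d′ = Vector.map +_ d

coordinate<csum : ∀ c → (∀ j → 0 < c j) → ∀ i → c i < csum c
coordinate<csum c c>0 0F = ℕₚ.m<m+n (c 0F) (ℕₚ.<-≤-trans (c>0 1F) (ℕₚ.m≤m+n _ _))
coordinate<csum c c>0 1F =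
  ℕₚ.<-≤-trans (ℕₚ.m<m+n (c 1F) (ℕₚ.<-≤-trans (c>0 2F) (ℕₚ.m≤m+n _ _))) (ℕₚ.m≤n+m _ (c 0F))
coordinate<csum c c>0 2F = ℕₚ.<-≤-trans (ℕₚ.m<m+n (c 2F) (c>0 3F))
  (ℕₚ.≤-trans (ℕₚ.m≤n+m _ (c 1F)) (ℕₚ.m≤n+m _ (c 0F)))
coordinate<csum c c>0 3F = ℕₚ.<-≤-trans (ℕₚ.m<n+m (c 3F) (c>0 2F))
  (ℕₚ.≤-trans (ℕₚ.m≤n+m _ (c 1F)) (ℕₚ.m≤n+m _ (c 0F)))

vol-replace-self : ∀ v i → vol (replace v i (v i)) ≡ vol v
vol-replace-self v 0F = refl
vol-replace-self v 1F = refl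
vol-replace-self v 2F = refl
vol-replace-self v 3F = refl

replace-self : ∀ v i (w : Pt) → replace v i w i ≡ w
replace-self v 0F w = refl
replace-self v 1F w = refl
replace-self v 2F w = refl
replace-self v 3F w = refl

replace-other : ∀ v {i j} (w : Pt) → j ≢ i → replace v i w j ≡ v j
replace-other v {i} {j} w j≢i with j ≟ i
... | yes j≡i = ⊥-elim (j≢i j≡i)
... | no _ = refl

replace-nondegenerate : ∀ {v w} → NonDegenerate v → InInterior v w → ∀ i → NonDegenerate (replace v i w)
replace-nondegenerate {v} {w} nd (d , d>0 , hd) i vol≡0
  with ℤₚ.i*j≡0⇒i≡0∨j≡0 (+ d i) (begin
    + d i * vol v                     ≡⟨ cramerℕ d hd i ⟨
    + csum d * vol (replace v i w)    ≡⟨ cong (+ csum d *_) vol≡0 ⟩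
    + csum d * + 0                    ≡⟨ ℤₚ.*-zeroʳ (+ csum d) ⟩
    + 0                               ∎)
... | inj₁ di≡0 = ℕₚ.<⇒≢ (d>0 i) (sym (ℤₚ.+-injective di≡0))
... | inj₂ vol≡0′ = nd vol≡0′

barycentric-unique : ∀ {v p} c d → NonDegenerate v → csum c · p ≡ lin c v → csum d · p ≡ lin d v →
  ∀ i → csum d ℕ.* c i ≡ csum c ℕ.* d i
barycentric-unique {v} {p} c d nd hc hd i = ℤₚ.+-injective (begin
  + (csum d ℕ.* c i)   ≡⟨ ℤₚ.pos-* (csum d) (c i) ⟩
  + csum d * + c i     ≡⟨ ℤₚ.*-cancelʳ-≡ _ _ (vol v) {{≢-nonZero nd}} cross ⟩
  + csum c * + d i     ≡⟨ ℤₚ.pos-* (csum c) (d i) ⟨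
  + (csum c ℕ.* d i)   ∎)
  where
  V′ = vol (replace v i p)
  cross : + csum d * + c i * vol v ≡ + csum c * + d i * vol v
  cross = begin
    + csum d * + c i * vol v    ≡⟨ ℤₚ.*-assoc (+ csum d) (+ c i) (vol v) ⟩
    + csum d * (+ c i * vol v)  ≡⟨ cong (+ csum d *_) (cramerℕ c hc i) ⟨
    + csum d * (+ csum c * V′)  ≡⟨ x∙yz≈y∙xz (+ csum d) (+ csum c) V′ ⟩
    + csum c * (+ csum d * V′)  ≡⟨ cong (+ csum c *_) (cramerℕ d hd i) ⟩
    + csum c * (+ d i * vol v)  ≡⟨ ℤₚ.*-assoc (+ csum c) (+ d i) (vol v) ⟨
    + csum c * + d i * vol v    ∎

vertex-coefficient : ∀ {v} c i → NonDegenerate v → csum c · v i ≡ lin c v → c i ≡ csum c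
vertex-coefficient {v} c i nd h =
  sym (ℤₚ.+-injective (ℤₚ.*-cancelʳ-≡ _ _ (vol v) {{≢-nonZero nd}} (begin
    + csum c * vol v                    ≡⟨ cong (+ csum c *_) (vol-replace-self v i) ⟨
    + csum c * vol (replace v i (v i))  ≡⟨ cramerℕ c h i ⟩
    + c i * vol v                       ∎)))

vertex-not-interior : ∀ {v} → NonDegenerate v → ∀ i → ¬ InInterior v (v i)
vertex-not-interior {v} nd i (c , c>0 , h) =
  ℕₚ.<⇒≢ (coordinate<csum c c>0 i) (vertex-coefficient {v} c i nd h)

zero-coordinate-not-interior : ∀ {v p} e i → NonDegenerate v → 0 < csum e → csum e · p ≡ lin e v →
  e i ≡ 0 → ¬ InInterior v p
zero-coordinate-not-interior {v} {p} e i nd e>0 he ei≡0 (f , f>0 , hf)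
  with ℕₚ.m*n≡0⇒m≡0∨n≡0 (csum e) (begin
    csum e ℕ.* f i  ≡⟨ barycentric-unique {v} {p} e f nd he hf i ⟨
    csum f ℕ.* e i  ≡⟨ cong (csum f ℕ.*_) ei≡0 ⟩
    csum f ℕ.* 0    ≡⟨ ℕₚ.*-zeroʳ (csum f) ⟩
    0               ∎)
... | inj₁ e≡0 = ℕₚ.<⇒≢ e>0 (sym e≡0)
... | inj₂ fi≡0 = ℕₚ.<⇒≢ (f>0 i) (sym fi≡0)

interior-through-replace : ∀ {v w p} c i → InInterior v w → csum c · p ≡ lin c (replace v i w) →
  0 < c i → InInterior v p
interior-through-replace {v} {w} {p} c i (d , d>0 , hd) hp ci>0 =
  substituteℕ i c d , positive , substituteℕ-barycentric i c d {v} {w} {p} hd hp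
  where
  positive : ∀ j → 0 < substituteℕ i c d j
  positive j = ℕₚ.<-≤-trans (ℕₚ.*-mono-< ci>0 (d>0 j)) (ℕₚ.m≤n+m _ _)

face-through-replace : ∀ {v w p} c i → InInterior v w → 0 < csum c → csum c · p ≡ lin c (replace v i w) →
  c i ≡ 0 → Σ (Fin 4 → ℕ) λ e → 0 < csum e × csum e · p ≡ lin e v × e i ≡ 0
face-through-replace {v} {w} {p} c i (d , d>0 , hd) c>0 hp ci≡0 =
  substituteℕ i c d ,
  subst (0 <_) (sym (csum-substituteℕ i c d))
    (ℕₚ.*-mono-< (ℕₚ.<-≤-trans (d>0 0F) (ℕₚ.m≤m+n _ _)) c>0) ,
  substituteℕ-barycentric i c d {v} {w} {p} hd hp ,
  (begin
    csum d ℕ.* updateAt c i (const 0) i ℕ.+ c i ℕ.* d i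
      ≡⟨ cong₂ (λ s t → csum d ℕ.* s ℕ.+ t ℕ.* d i) (updateAt-updates i c) ci≡0 ⟩
    csum d ℕ.* 0 ℕ.+ 0
      ≡⟨ cong (ℕ._+ 0) (ℕₚ.*-zeroʳ (csum d)) ⟩
    0 ∎)

clean-face-vertex : ∀ {v p} e i → NonDegenerate v → Clean v → 0 < csum e → csum e · p ≡ lin e v →
  e i ≡ 0 → ∃ λ j → j ≢ i × p ≡ v j
clean-face-vertex {v} {p} e i nd clean e>0 he ei≡0 = j , j≢i , p≡vj
  where
  vertex = clean p ((e , e>0 , he) , zero-coordinate-not-interior {v} {p} e i nd e>0 he ei≡0)
  j = proj₁ vertex
  p≡vj = proj₂ vertex
  j≢i : j ≢ i
  j≢i j≡i = ℕₚ.<⇒≢ e>0 (trans (sym ei≡0) (vertex-coefficient {v} e i nd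
    (subst (λ q → csum e · q ≡ lin e v) (trans p≡vj (cong v j≡i)) he)))

lemma9 : (v : Tet) (w : Pt) → OnePointTetWith v w →
    (i : Fin 4) → EmptyTet (replace v i w)
lemma9 v w (nd , clean , w-interior , unique) i = nd′ , clean′ , no-interior
  where
  nd′ : NonDegenerate (replace v i w)
  nd′ = replace-nondegenerate {v} {w} nd w-interior i

  is-w : ∀ {p} c → csum c · p ≡ lin c (replace v i w) → 0 < c i → p ≡ w
  is-w {p} c hp ci>0 = unique p (interior-through-replace {v} {w} {p} c i w-interior hp ci>0)

  no-interior : ∀ p → ¬ InInterior (replace v i w) p
  no-interior p p-interior@(c , c>0 , hp) = vertex-not-interior {replace v i w} nd′ i
    (subst (InInterior (replace v i w)) (trans (is-w c hp (c>0 i)) (sym (replace-self v i w))) p-interior)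

  clean′ : Clean (replace v i w)
  clean′ p ((c , c>0 , hp) , _) = by-weight (c i) refl
    where
    by-weight : ∀ n → c i ≡ n → ∃ λ j → p ≡ replace v i w j
    by-weight (suc _) ci = i , trans (is-w c hp (subst (0 <_) (sym ci) z<s)) (sym (replace-self v i w))
    by-weight zero ci =
      let e , e>0 , he , ei≡0 = face-through-replace {v} {w} {p} c i w-interior c>0 hp ci
          j , j≢i , p≡vj = clean-face-vertex {v} {p} e i nd clean e>0 he ei≡0
      in j , trans p≡vj (sym (replace-other v w j≢i))
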